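{- Let $S$ be a spider with $k\geq 3$ legs, each leg having length at least $2$. Then \[\mathrm{max}\text{ - }\overline{\mathrm{cr}}(S)\leq \vartheta(S)-\left(\binom{k}{2}-\left\lfloor\frac{k^2}{4}\right\rfloor\right).\]
   Context: A spider is a subdivision of the star $K_{1,k}$; each path from the degree-$k$ center vertex to a leaf is a leg, and the length of a leg is its number of edges. A good drawing of a graph in the plane is one in which no edge crosses itself, any two edges share at most one point (counting endpoints), no three edges share a common interior crossing point, and edges do not contain vertices in their interior. A rectilinear drawing is a good drawing in which every edge is a straight line segment. The maximum rectilinear crossing number $\mathrm{max}\text{ - }\overline{\mathrm{cr}}(G)$ is the maximum number of crossings over all rectilinear drawings of $G$. The thrackle bound of a graph $G$ is $\vartheta(G)=\binom{|E(G)|}{2}-\sum_{u\in V(G)}\binom{\deg(u)}{2}$.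
   Formalization: The rectilinear drawings of S have their vertices at points with rational coordinates rather than at arbitrary points of the plane. -}

module Defs where

open import Data.Nat as ℕ using (ℕ; zero; suc; _∸_)
open import Data.Nat.Properties using (≤-trans; n≤1+n)
import Data.Fin
import Data.Nat.Properties
import Relation.Nullary
open import Data.Nat.Combinatorics using (_C_)
open import Data.Fin using (Fin; toℕ)
open import Data.Maybe using (Maybe; just; nothing)
open import Data.Product using (Σ; ∃; _×_; _,_)
open import Data.Sum using (_⊎_)
open import Data.Rational as ℚ using (ℚ; 0ℚ; 1ℚ)
open import Relation.Binary.PropositionalEquality using (_≡_; _≢_)
open import Relation.Nullary using (¬_)

finSum : (n : ℕ) → (Fin n → ℕ) → ℕ
finSum zero f = 0
finSum (suc n) f = f Data.Fin.zero ℕ.+ finSum n (λ i → f (Data.Fin.suc i))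

-- Spider with k legs, leg i of length ℓ i.
-- A non-center vertex is (i , j , _) : the vertex at distance j+1 from the
-- center on leg i (0 ≤ j < ℓ i).
LegVertex : (k : ℕ) → (Fin k → ℕ) → Set
LegVertex k ℓ = Σ (Fin k) λ i → Σ ℕ λ j → j ℕ.< ℓ i

-- nothing = the center vertex
Vertex : (k : ℕ) → (Fin k → ℕ) → Set
Vertex k ℓ = Maybe (LegVertex k ℓ)

-- Each non-center vertex v determines exactly one edge: from v to its
-- neighbour one step closer to the center.
Edge : (k : ℕ) → (Fin k → ℕ) → Set
Edge = LegVertex

outer : ∀ {k ℓ} → Edge k ℓ → Vertex k ℓ
outer e = just e

inner : ∀ {k ℓ} → Edge k ℓ → Vertex k ℓ
inner (i , zero , p) = nothing
inner (i , suc j , p) = just (i , j , ≤-trans (n≤1+n _) p)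

degree : ∀ {k ℓ} → Vertex k ℓ → ℕ
degree {k} nothing = k
degree {k} {ℓ} (just (i , j , _)) with suc j ℕ.≟ ℓ i
... | Relation.Nullary.yes _ = 1
... | Relation.Nullary.no _ = 2

numEdges : (k : ℕ) → (Fin k → ℕ) → ℕ
numEdges k ℓ = finSum k ℓ

legSum : ∀ {k ℓ} (i : Fin k) (n : ℕ) → n ℕ.≤ ℓ i → ℕ
legSum i zero _ = 0
legSum {k} {ℓ} i (suc n) p =
  (degree {k} {ℓ} (just (i , n , p)) C 2) ℕ.+ legSum {k} {ℓ} i n (≤-trans (n≤1+n n) p)

sumDegC2 : (k : ℕ) → (ℓ : Fin k → ℕ) → ℕ
sumDegC2 k ℓ = (degree {k} {ℓ} nothing C 2)
  ℕ.+ finSum k (λ i → legSum {k} {ℓ} i (ℓ i) Data.Nat.Properties.≤-refl)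

thrackle : (k : ℕ) → (Fin k → ℕ) → ℕ
thrackle k ℓ = (numEdges k ℓ C 2) ∸ sumDegC2 k ℓ

Point : Set
Point = ℚ × ℚ

_at_ : Point × Point → ℚ → Point
((ax , ay) , (bx , by)) at t = (ax ℚ.+ t ℚ.* (bx ℚ.- ax)) , (ay ℚ.+ t ℚ.* (by ℚ.- ay))

OnClosedSeg : Point → Point → Point → Set
OnClosedSeg a b p = ∃ λ t → (0ℚ ℚ.≤ t) × (t ℚ.≤ 1ℚ) × (p ≡ (a , b) at t)

OnOpenSeg : Point → Point → Point → Set
OnOpenSeg a b p = ∃ λ t → (0ℚ ℚ.< t) × (t ℚ.< 1ℚ) × (p ≡ (a , b) at t)

-- A rectilinear drawing: vertex positions, edges drawn as segments.
Drawing : (k : ℕ) → (Fin k → ℕ) → Set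
Drawing k ℓ = Vertex k ℓ → Point

module _ {k : ℕ} {ℓ : Fin k → ℕ} (D : Drawing k ℓ) where

  OnEdge : Edge k ℓ → Point → Set
  OnEdge e = OnClosedSeg (D (inner e)) (D (outer e))

  InteriorOfEdge : Edge k ℓ → Point → Set
  InteriorOfEdge e = OnOpenSeg (D (inner e)) (D (outer e))

  record IsGood : Set where
    field
      injective    : ∀ u v → D u ≡ D v → u ≡ v
      noVertexOnEdge : ∀ (v : Vertex k ℓ) (e : Edge k ℓ) → ¬ InteriorOfEdge e (D v)
      atMostOnePoint : ∀ (e f : Edge k ℓ) → e ≢ f → ∀ p q →
        OnEdge e p → OnEdge f p → OnEdge e q → OnEdge f q → p ≡ q
      noTripleCrossing : ∀ (e f g : Edge k ℓ) → e ≢ f → f ≢ g → e ≢ g → ∀ p →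
        ¬ (InteriorOfEdge e p × InteriorOfEdge f p × InteriorOfEdge g p)

  Cross : Edge k ℓ → Edge k ℓ → Set
  Cross e f = e ≢ f × ∃ λ p → InteriorOfEdge e p × InteriorOfEdge f p

-- strict order on edges, used to count unordered pairs once
EdgeLt : ∀ {k ℓ} → Edge k ℓ → Edge k ℓ → Set
EdgeLt (i , j , _) (i' , j' , _) = (toℕ i ℕ.< toℕ i') ⊎ ((i ≡ i') × (j ℕ.< j'))

-- In a good drawing, edges sharing a vertex do not cross, so the crossings of S are
-- among the ϑ(S) pairs of non-adjacent edges.  Colour each leg i by the orientation of the triangle
-- (c, aᵢ, bᵢ) formed by the centre and the first two vertices of the leg.  If the first edge of leg i
-- crosses the second edge of leg j, at p = c + t (aᵢ − c) = aⱼ + s (bⱼ − aⱼ) with 0 < s, t < 1, then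
-- t · orient(c, aⱼ, aᵢ) = s · orient(c, aⱼ, bⱼ), and the good-drawing conditions rule out
-- orient(c, aⱼ, bⱼ) = 0 (the four points would be collinear with overlapping edges).  Hence if both
-- crossings between the first two edges of legs i and j occur, antisymmetry of orient(c, ·, ·) gives
-- the two legs different colours.  So each monochromatic pair of legs misses a crossing, and any
-- 2-colouring of k legs has at least C(k,2) − ⌊k²/4⌋ monochromatic pairs.

module Submission where

open import Data.Bool using (Bool; true; false)
import Data.Bool.Properties as Bool
open import Data.Empty using (⊥-elim)
open import Data.Fin using (Fin; toℕ) renaming (zero to fzero; suc to fsuc)
import Data.Fin.Properties as Fin
open import Data.List using (List; []; _∷_; _++_; map; length; cartesianProduct; cartesianProductWith)
open import Data.List.Properties using (length-map; length-++; length-removeAt′)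
import Data.List.Membership.DecPropositional as DecMembership
open import Data.List.Membership.Propositional using (_∈_; _─_)
open import Data.List.Membership.Propositional.Properties using (∈-map⁺; ∈-++⁺ˡ; ∈-++⁺ʳ; ∈-cartesianProduct⁺)
open import Data.List.Relation.Binary.Subset.Propositional using (_⊆_)
open import Data.List.Relation.Unary.All as All using (All)
open import Data.List.Relation.Unary.AllPairs using (_∷_)
open import Data.List.Relation.Unary.Any using (here; there; index)
open import Data.List.Relation.Unary.Unique.Propositional using (Unique)
open import Data.Maybe using (just; nothing)
open import Data.Maybe.Properties using (just-injective)
open import Data.Product using (Σ; ∃; _×_; _,_; proj₁; proj₂; map₂; swap)
open import Data.Product.Properties using (≡-dec)
open import Data.Sum using (_⊎_; inj₁; inj₂; [_,_]′)
open import Data.Unit using (⊤; tt)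
open import Defs
open import Function using (_∘_; _∋_; case_of_)
open import Relation.Binary.Definitions using (DecidableEquality; tri<; tri≈; tri>)
open import Relation.Binary.PropositionalEquality
open import Relation.Nullary using (¬_; yes; no; does)

module Plane where

  open import Data.Rational using (ℚ; 0ℚ; 1ℚ; _+_; _*_; _-_; -_; _<_; 1/_; ≢-nonZero; positive)
  open import Data.Rational.Properties
  open import Algebra.Properties.Group +-0-group using (x∙y⁻¹≈ε⇒x≈y) renaming (∙-cancelˡ to +-cancelˡ)
  open import Level using (0ℓ)
  open import Relation.Nullary.Decidable using (dec⇒maybe; dec-true; dec-false)
  open import Tactic.RingSolver using (solve-∀; solve)
  open import Tactic.RingSolver.Core.AlmostCommutativeRing using (AlmostCommutativeRing; fromCommutativeRing)

  ℚ-ring : AlmostCommutativeRing 0ℓ 0ℓ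
  ℚ-ring = fromCommutativeRing +-*-commutativeRing (λ x → dec⇒maybe (0ℚ ≟ x))

  x≢0⇒x*y≡0⇒y≡0 : ∀ {x y} → x ≢ 0ℚ → x * y ≡ 0ℚ → y ≡ 0ℚ
  x≢0⇒x*y≡0⇒y≡0 {x} {y} x≢0 xy≡0 = begin
    y                ≡⟨ *-identityˡ y ⟨
    1ℚ * y           ≡⟨ cong (_* y) (*-inverseˡ x) ⟨
    1/ x * x * y     ≡⟨ *-assoc (1/ x) x y ⟩
    1/ x * (x * y)   ≡⟨ cong (1/ x *_) xy≡0 ⟩
    1/ x * 0ℚ        ≡⟨ *-zeroʳ (1/ x) ⟩
    0ℚ               ∎
    where
    open ≡-Reasoning
    instance _ = ≢-nonZero x≢0

  x-y≡0⇒x≡y : ∀ {x y} → x - y ≡ 0ℚ → x ≡ y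
  x-y≡0⇒x≡y = x∙y⁻¹≈ε⇒x≈y _ _

  *-cancelʳ-≢0 : ∀ {x y w} → w ≢ 0ℚ → x * w ≡ y * w → x ≡ y
  *-cancelʳ-≢0 {x} {y} {w} w≢0 xw≡yw = x-y≡0⇒x≡y (x≢0⇒x*y≡0⇒y≡0 w≢0 (begin
    w * (x - y)      ≡⟨ solve (x ∷ y ∷ w ∷ []) ℚ-ring ⟩
    x * w - y * w    ≡⟨ cong (_- y * w) xw≡yw ⟩
    y * w - y * w    ≡⟨ +-inverseʳ (y * w) ⟩
    0ℚ               ∎))
    where open ≡-Reasoning

  orientation : Point → Point → Point → ℚ
  orientation (cx , cy) (ax , ay) (bx , by) = (ax - cx) * (by - cy) - (ay - cy) * (bx - cx)

  -- The ring solver does not unfold orientation or _at_, so these identities are stated on coordinates.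
  orientation-antisym : ∀ c a b → orientation c a b ≡ - orientation c b a
  orientation-antisym (cx , cy) (ax , ay) (bx , by) = lemma cx cy ax ay bx by
    where
    lemma : ∀ cx cy ax ay bx by →
      (ax - cx) * (by - cy) - (ay - cy) * (bx - cx) ≡ - ((bx - cx) * (ay - cy) - (by - cy) * (ax - cx))
    lemma = solve-∀ ℚ-ring

  at-0 : ∀ c a → (c , a) at 0ℚ ≡ c
  at-0 (cx , cy) (ax , ay) = cong₂ _,_ (solve (cx ∷ ax ∷ []) ℚ-ring) (solve (cy ∷ ay ∷ []) ℚ-ring)

  at-1 : ∀ c a → (c , a) at 1ℚ ≡ a
  at-1 (cx , cy) (ax , ay) = cong₂ _,_ (solve (cx ∷ ax ∷ []) ℚ-ring) (solve (cy ∷ ay ∷ []) ℚ-ring)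

  at-at : ∀ c a α β s → ((c , a) at α , (c , a) at β) at s ≡ (c , a) at (α + s * (β - α))
  at-at (cx , cy) (ax , ay) α β s = cong₂ _,_ (lemma cx ax) (lemma cy ay)
    where
    lemma : ∀ c a → (c + α * (a - c)) + s * ((c + β * (a - c)) - (c + α * (a - c)))
                    ≡ c + (α + s * (β - α)) * (a - c)
    lemma c a = solve (c ∷ a ∷ α ∷ β ∷ s ∷ []) ℚ-ring

  orientation-atʳ : ∀ c a b t → orientation c a ((c , b) at t) ≡ t * orientation c a b
  orientation-atʳ (cx , cy) (ax , ay) (bx , by) t = lemma cx cy ax ay bx by t
    where
    lemma : ∀ cx cy ax ay bx by t →
      (ax - cx) * ((cy + t * (by - cy)) - cy) - (ay - cy) * ((cx + t * (bx - cx)) - cx)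
        ≡ t * ((ax - cx) * (by - cy) - (ay - cy) * (bx - cx))
    lemma = solve-∀ ℚ-ring

  orientation-atˡ : ∀ c a b t → orientation c ((c , a) at t) b ≡ t * orientation c a b
  orientation-atˡ c a b t = begin
    orientation c ((c , a) at t) b      ≡⟨ orientation-antisym c ((c , a) at t) b ⟩
    - orientation c b ((c , a) at t)    ≡⟨ cong -_ (orientation-atʳ c b a t) ⟩
    - (t * orientation c b a)           ≡⟨ neg-distribʳ-* t _ ⟩
    t * - orientation c b a             ≡⟨ cong (t *_) (orientation-antisym c a b) ⟨
    t * orientation c a b               ∎
    where open ≡-Reasoning

  orientation-from : ∀ c a b t → orientation c a ((a , b) at t) ≡ t * orientation c a b
  orientation-from (cx , cy) (ax , ay) (bx , by) t = lemma cx cy ax ay bx by t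
    where
    lemma : ∀ cx cy ax ay bx by t →
      (ax - cx) * ((ay + t * (by - ay)) - cy) - (ay - cy) * ((ax + t * (bx - ax)) - cx)
        ≡ t * ((ax - cx) * (by - cy) - (ay - cy) * (bx - cx))
    lemma = solve-∀ ℚ-ring

  crossing-orientations : ∀ c a q b t s → (c , a) at t ≡ (q , b) at s →
    t * orientation c q a ≡ s * orientation c q b
  crossing-orientations c a q b t s eq = begin
    t * orientation c q a            ≡⟨ orientation-atʳ c q a t ⟨
    orientation c q ((c , a) at t)   ≡⟨ cong (orientation c q) eq ⟩
    orientation c q ((q , b) at s)   ≡⟨ orientation-from c q b s ⟩
    s * orientation c q b            ∎
    where open ≡-Reasoning

  SameSign : ℚ → ℚ → Set
  SameSign x y = (0ℚ < x × 0ℚ < y) ⊎ (x < 0ℚ × y < 0ℚ)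

  module _ {t s x y} (0<t : 0ℚ < t) (0<s : 0ℚ < s) (tx≡sy : t * x ≡ s * y) where

    private
      s0≡t0 : s * 0ℚ ≡ t * 0ℚ
      s0≡t0 = trans (*-zeroʳ s) (sym (*-zeroʳ t))
      cancel-t : ∀ {p q} → t * p < t * q → p < q
      cancel-t = *-cancelˡ-<-nonNeg t {{pos⇒nonNeg t {{positive 0<t}}}}
      mono-s : ∀ {p q} → p < q → s * p < s * q
      mono-s = *-monoʳ-<-pos s {{positive 0<s}}

    positive-multiples-sameSign : y ≢ 0ℚ → SameSign x y
    positive-multiples-sameSign y≢0 with <-cmp y 0ℚ
    ... | tri< y<0 _ _ = inj₂ (cancel-t (subst₂ _<_ (sym tx≡sy) s0≡t0 (mono-s y<0)) , y<0)
    ... | tri≈ _ y≡0 _ = ⊥-elim (y≢0 y≡0)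
    ... | tri> _ _ 0<y = inj₁ (cancel-t (subst₂ _<_ s0≡t0 (sym tx≡sy) (mono-s 0<y)) , 0<y)

  isPositive : ℚ → Bool
  isPositive x = does (0ℚ <? x)

  sameSign-opposite⇒≢ : ∀ {x y u v} → SameSign u x → SameSign v y → u ≡ - v → isPositive x ≢ isPositive y
  sameSign-opposite⇒≢ (inj₁ (0<u , _)) (inj₁ (0<v , _)) u≡-v _ =
    <-asym 0<u (subst (_< 0ℚ) (sym u≡-v) (neg-antimono-< 0<v))
  sameSign-opposite⇒≢ (inj₂ (u<0 , _)) (inj₂ (v<0 , _)) u≡-v _ =
    <-asym u<0 (subst (0ℚ <_) (sym u≡-v) (neg-antimono-< v<0))
  sameSign-opposite⇒≢ {x} {y} (inj₁ (_ , 0<x)) (inj₂ (_ , y<0)) _ eq =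
    case trans (sym (dec-true (0ℚ <? x) 0<x)) (trans eq (dec-false (0ℚ <? y) (<-asym y<0))) of λ ()
  sameSign-opposite⇒≢ {x} {y} (inj₂ (_ , x<0)) (inj₁ (_ , 0<y)) _ eq =
    case trans (sym (dec-true (0ℚ <? y) 0<y)) (trans (sym eq) (dec-false (0ℚ <? x) (<-asym x<0))) of λ ()

  ≢⇒coordinate-difference-≢0 : ∀ {ax ay cx cy} → (ax , ay) ≢ (cx , cy) → ax - cx ≢ 0ℚ ⊎ ay - cy ≢ 0ℚ
  ≢⇒coordinate-difference-≢0 {ax} {ay} {cx} {cy} a≢c with ax - cx ≟ 0ℚ
  ... | no  dx≢0 = inj₁ dx≢0
  ... | yes dx≡0 = inj₂ λ dy≡0 → a≢c (cong₂ _,_ (x-y≡0⇒x≡y dx≡0) (x-y≡0⇒x≡y dy≡0))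

  at-injective : ∀ c a x y → a ≢ c → (c , a) at x ≡ (c , a) at y → x ≡ y
  at-injective (cx , cy) (ax , ay) x y a≢c eq with ≢⇒coordinate-difference-≢0 a≢c
  ... | inj₁ dx≢0 = *-cancelʳ-≢0 dx≢0 (+-cancelˡ cx _ _ (cong proj₁ eq))
  ... | inj₂ dy≢0 = *-cancelʳ-≢0 dy≢0 (+-cancelˡ cy _ _ (cong proj₂ eq))

  parallel⇒multipleˣ : ∀ {ux uy wx wy} → wx ≢ 0ℚ → wx * uy ≡ wy * ux → ∃ λ α → ux ≡ α * wx × uy ≡ α * wy
  parallel⇒multipleˣ {ux} {uy} {wx} {wy} wx≢0 cross≡0 = ux * 1/ wx , by-inverse (*-inverseʳ wx)
    where
    instance _ = ≢-nonZero wx≢0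
    by-inverse : ∀ {i} → wx * i ≡ 1ℚ → ux ≡ ux * i * wx × uy ≡ ux * i * wy
    by-inverse {i} wx*i≡1 = ux≡ , uy≡
      where
      open ≡-Reasoning
      ux≡ : ux ≡ ux * i * wx
      ux≡ = begin
        ux                ≡⟨ *-identityʳ ux ⟨
        ux * 1ℚ           ≡⟨ cong (ux *_) wx*i≡1 ⟨
        ux * (wx * i)     ≡⟨ solve (ux ∷ wx ∷ i ∷ []) ℚ-ring ⟩
        ux * i * wx       ∎
      uy≡ : uy ≡ ux * i * wy
      uy≡ = begin
        uy                ≡⟨ *-identityʳ uy ⟨
        uy * 1ℚ           ≡⟨ cong (uy *_) wx*i≡1 ⟨
        uy * (wx * i)     ≡⟨ solve (uy ∷ wx ∷ i ∷ []) ℚ-ring ⟩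
        wx * uy * i       ≡⟨ cong (_* i) cross≡0 ⟩
        wy * ux * i       ≡⟨ solve (ux ∷ wy ∷ i ∷ []) ℚ-ring ⟩
        ux * i * wy       ∎

  parallel⇒multiple : ∀ {ux uy wx wy} → wx ≢ 0ℚ ⊎ wy ≢ 0ℚ → wx * uy ≡ wy * ux →
    ∃ λ α → ux ≡ α * wx × uy ≡ α * wy
  parallel⇒multiple (inj₁ wx≢0) parallel = parallel⇒multipleˣ wx≢0 parallel
  parallel⇒multiple (inj₂ wy≢0) parallel = map₂ swap (parallel⇒multipleˣ wy≢0 (sym parallel))

  x-y≡z⇒x≡y+z : ∀ {x y z} → x - y ≡ z → x ≡ y + z
  x-y≡z⇒x≡y+z {x} {y} refl = solve (x ∷ y ∷ []) ℚ-ring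

  collinear⇒at : ∀ c a q → a ≢ c → orientation c a q ≡ 0ℚ → ∃ λ α → q ≡ (c , a) at α
  collinear⇒at (cx , cy) (ax , ay) (qx , qy) a≢c o≡0
    with α , ux≡ , uy≡ ← parallel⇒multiple (≢⇒coordinate-difference-≢0 a≢c) (x-y≡0⇒x≡y o≡0) =
    α , cong₂ _,_ (x-y≡z⇒x≡y+z ux≡) (x-y≡z⇒x≡y+z uy≡)

  at-outside : ∀ c a α → (c , a) at α ≢ c → (c , a) at α ≢ a → ¬ OnOpenSeg c a ((c , a) at α) →
    α < 0ℚ ⊎ 1ℚ < α
  at-outside c a α ≢c ≢a ∉open with <-cmp α 0ℚ | <-cmp α 1ℚ
  ... | tri< α<0 _ _  | _            = inj₁ α<0
  ... | tri≈ _ refl _ | _            = ⊥-elim (≢c (at-0 c a))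
  ... | tri> _ _ 0<α  | tri< α<1 _ _ = ⊥-elim (∉open (α , 0<α , α<1 , refl))
  ... | tri> _ _ _    | tri≈ _ refl _ = ⊥-elim (≢a (at-1 c a))
  ... | tri> _ _ _    | tri> _ _ 1<α = inj₂ 1<α

  0<1 : 0ℚ < 1ℚ
  0<1 = positive⁻¹ 1ℚ

  p<q⇒0<q-p : ∀ {p q} → p < q → 0ℚ < q - p
  p<q⇒0<q-p {p} {q} p<q = subst (_< q - p) (+-inverseʳ p) (+-monoˡ-< (- p) p<q)

  module _ {s} (0<s : 0ℚ < s) (s<1 : s < 1ℚ) where

    private
      mono-s : ∀ {p q} → p < q → s * p < s * q
      mono-s = *-monoʳ-<-pos s {{positive 0<s}}
      mono-1-s : ∀ {p q} → p < q → (1ℚ - s) * p < (1ℚ - s) * q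
      mono-1-s = *-monoʳ-<-pos (1ℚ - s) {{positive (p<q⇒0<q-p s<1)}}
      convex : ∀ x y → x + s * (y - x) ≡ (1ℚ - s) * x + s * y
      convex x y = solve (x ∷ y ∷ s ∷ []) ℚ-ring
      split : ∀ m → (1ℚ - s) * m + s * m ≡ m
      split m = solve (m ∷ s ∷ []) ℚ-ring

    convex-< : ∀ {x y m} → x < m → y < m → x + s * (y - x) < m
    convex-< {x} {y} {m} x<m y<m = begin-strict
      x + s * (y - x)         ≡⟨ convex x y ⟩
      (1ℚ - s) * x + s * y    <⟨ +-mono-< (mono-1-s x<m) (mono-s y<m) ⟩
      (1ℚ - s) * m + s * m    ≡⟨ split m ⟩
      m                       ∎
      where open ≤-Reasoning

    convex-> : ∀ {x y m} → m < x → m < y → m < x + s * (y - x)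
    convex-> {x} {y} {m} m<x m<y = begin-strict
      m                       ≡⟨ split m ⟨
      (1ℚ - s) * m + s * m    <⟨ +-mono-< (mono-1-s m<x) (mono-s m<y) ⟩
      (1ℚ - s) * x + s * y    ≡⟨ convex x y ⟨
      x + s * (y - x)         ∎
      where open ≤-Reasoning

  ∃-fraction : ∀ {p q} → 0ℚ < p → 0ℚ < q → ∃ λ l → 0ℚ < l × l < 1ℚ × l * (p + q) ≡ p
  ∃-fraction {p} {q} 0<p 0<q = p * 1/ (p + q) , 0<l , l<1 , l*[p+q]≡p
    where
    instance
      p-positive   = positive 0<p
      p+q-positive = pos+pos⇒pos p q {{positive 0<q}}
      p+q-nonZero  = pos⇒nonZero (p + q)
      1/[p+q]-positive = 1/pos⇒pos (p + q)
    l*[p+q]≡p : p * 1/ (p + q) * (p + q) ≡ p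
    l*[p+q]≡p = begin
      p * 1/ (p + q) * (p + q)    ≡⟨ *-assoc p _ _ ⟩
      p * (1/ (p + q) * (p + q))  ≡⟨ cong (p *_) (*-inverseˡ (p + q)) ⟩
      p * 1ℚ                      ≡⟨ *-identityʳ p ⟩
      p                           ∎
      where open ≡-Reasoning
    0<l : 0ℚ < p * 1/ (p + q)
    0<l = positive⁻¹ _ {{pos*pos⇒pos p (1/ (p + q))}}
    l<1 : p * 1/ (p + q) < 1ℚ
    l<1 = *-cancelʳ-<-nonNeg (p + q) {{pos⇒nonNeg (p + q)}} (begin-strict
      p * 1/ (p + q) * (p + q)    ≡⟨ l*[p+q]≡p ⟩
      p                           ≡⟨ +-identityʳ p ⟨
      p + 0ℚ                      <⟨ +-monoʳ-< p 0<q ⟩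
      p + q                       ≡⟨ *-identityˡ (p + q) ⟨
      1ℚ * (p + q)                ∎)
      where open ≤-Reasoning

  outside-unit-interval-crosses-0 : ∀ {α β s} → α < 0ℚ ⊎ 1ℚ < α → β < 0ℚ ⊎ 1ℚ < β →
    0ℚ < s → s < 1ℚ → 0ℚ < α + s * (β - α) → α + s * (β - α) < 1ℚ →
    ∃ λ l → 0ℚ < l × l < 1ℚ × α + l * (β - α) ≡ 0ℚ
  outside-unit-interval-crosses-0 (inj₁ α<0) (inj₁ β<0) 0<s s<1 0<γ _ =
    ⊥-elim (<-asym 0<γ (convex-< 0<s s<1 α<0 β<0))
  outside-unit-interval-crosses-0 (inj₂ 1<α) (inj₂ 1<β) 0<s s<1 _ γ<1 =
    ⊥-elim (<-asym γ<1 (convex-> 0<s s<1 1<α 1<β))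
  outside-unit-interval-crosses-0 {α} {β} (inj₁ α<0) (inj₂ 1<β) _ _ _ _ =
    let l , 0<l , l<1 , eq = ∃-fraction (neg-antimono-< α<0) (<-trans 0<1 1<β) in l , 0<l , l<1 , root l eq
    where
    root : ∀ l → l * (- α + β) ≡ - α → α + l * (β - α) ≡ 0ℚ
    root l l*[-α+β]≡-α = begin
      α + l * (β - α)      ≡⟨ solve (α ∷ β ∷ l ∷ []) ℚ-ring ⟩
      α + l * (- α + β)    ≡⟨ cong (α +_) l*[-α+β]≡-α ⟩
      α - α                ≡⟨ +-inverseʳ α ⟩
      0ℚ                   ∎
      where open ≡-Reasoning
  outside-unit-interval-crosses-0 {α} {β} (inj₂ 1<α) (inj₁ β<0) _ _ _ _ =
    let l , 0<l , l<1 , eq = ∃-fraction (<-trans 0<1 1<α) (neg-antimono-< β<0) in l , 0<l , l<1 , root l eq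
    where
    root : ∀ l → l * (α - β) ≡ α → α + l * (β - α) ≡ 0ℚ
    root l l*[α-β]≡α = begin
      α + l * (β - α)      ≡⟨ solve (α ∷ β ∷ l ∷ []) ℚ-ring ⟩
      α - l * (α - β)      ≡⟨ cong (λ x → α - x) l*[α-β]≡α ⟩
      α - α                ≡⟨ +-inverseʳ α ⟩
      0ℚ                   ∎
      where open ≡-Reasoning

  crossing-collinear : ∀ c a q b t s → 0ℚ < t → (c , a) at t ≡ (q , b) at s →
    orientation c q b ≡ 0ℚ → orientation c a q ≡ 0ℚ
  crossing-collinear c a q b t s 0<t ct≡qs o[cqb]≡0 =
    trans (orientation-antisym c a q) (cong -_ (x≢0⇒x*y≡0⇒y≡0 (≢-sym (<⇒≢ 0<t)) (begin
      t * orientation c q a   ≡⟨ crossing-orientations c a q b t s ct≡qs ⟩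
      s * orientation c q b   ≡⟨ cong (s *_) o[cqb]≡0 ⟩
      s * 0ℚ                  ≡⟨ *-zeroʳ s ⟩
      0ℚ                      ∎)))
    where open ≡-Reasoning

  collinear-crossing⇒∈ : ∀ c a α β {t s} → a ≢ c →
    α < 0ℚ ⊎ 1ℚ < α → β < 0ℚ ⊎ 1ℚ < β → 0ℚ < t → t < 1ℚ → 0ℚ < s → s < 1ℚ →
    (c , a) at t ≡ ((c , a) at α , (c , a) at β) at s → OnOpenSeg ((c , a) at α) ((c , a) at β) c
  collinear-crossing⇒∈ c a α β {t} {s} a≢c α∉ β∉ 0<t t<1 0<s s<1 ct≡qs =
    let l , 0<l , l<1 , γₗ≡0 = outside-unit-interval-crosses-0 α∉ β∉ 0<s s<1
                                 (subst (0ℚ <_) t≡γ 0<t) (subst (_< 1ℚ) t≡γ t<1)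
    in l , 0<l , l<1 , c≡ l γₗ≡0
    where
    open ≡-Reasoning
    t≡γ : t ≡ α + s * (β - α)
    t≡γ = at-injective c a t (α + s * (β - α)) a≢c (trans ct≡qs (at-at c a α β s))
    c≡ : ∀ l → α + l * (β - α) ≡ 0ℚ → c ≡ ((c , a) at α , (c , a) at β) at l
    c≡ l γₗ≡0 = sym (begin
      ((c , a) at α , (c , a) at β) at l   ≡⟨ at-at c a α β l ⟩
      (c , a) at (α + l * (β - α))         ≡⟨ cong ((c , a) at_) γₗ≡0 ⟩
      (c , a) at 0ℚ                        ≡⟨ at-0 c a ⟩
      c                                    ∎)

  crossing⇒orientation≢0 : ∀ c a q b {p} → OnOpenSeg c a p → OnOpenSeg q b p →
    a ≢ c → q ≢ c → q ≢ a → b ≢ c → b ≢ a →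
    ¬ OnOpenSeg c a q → ¬ OnOpenSeg c a b → ¬ OnOpenSeg q b c →
    orientation c q b ≢ 0ℚ
  crossing⇒orientation≢0 c a q b (t , 0<t , t<1 , p≡ct) (s , 0<s , s<1 , p≡qs)
    a≢c q≢c q≢a b≢c b≢a q∉ca b∉ca c∉qb o[cqb]≡0 =
    c∉qb (subst₂ (λ q b → OnOpenSeg q b c) (sym q≡) (sym b≡)
      (collinear-crossing⇒∈ c a α β a≢c α∉ β∉ 0<t t<1 0<s s<1
        (trans ct≡qs (cong₂ (λ q b → (q , b) at s) q≡ b≡))))
    where
    ct≡qs : (c , a) at t ≡ (q , b) at s
    ct≡qs = trans (sym p≡ct) p≡qs
    q-on-ca : ∃ λ α → q ≡ (c , a) at α
    q-on-ca = collinear⇒at c a q a≢c (crossing-collinear c a q b t s 0<t ct≡qs o[cqb]≡0)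
    α : ℚ
    α = proj₁ q-on-ca
    q≡ : q ≡ (c , a) at α
    q≡ = proj₂ q-on-ca
    α≢0 : α ≢ 0ℚ
    α≢0 α≡0 = q≢c (trans q≡ (trans (cong ((c , a) at_) α≡0) (at-0 c a)))
    α*o[cab]≡0 : α * orientation c a b ≡ 0ℚ
    α*o[cab]≡0 = trans (sym (orientation-atˡ c a b α))
                       (trans (cong (λ q → orientation c q b) (sym q≡)) o[cqb]≡0)
    b-on-ca : ∃ λ β → b ≡ (c , a) at β
    b-on-ca = collinear⇒at c a b a≢c (x≢0⇒x*y≡0⇒y≡0 α≢0 α*o[cab]≡0)
    β : ℚ
    β = proj₁ b-on-ca
    b≡ : b ≡ (c , a) at β
    b≡ = proj₂ b-on-ca
    α∉ : α < 0ℚ ⊎ 1ℚ < α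
    α∉ = at-outside c a α (q≢c ∘ trans q≡) (q≢a ∘ trans q≡) (q∉ca ∘ subst (OnOpenSeg c a) (sym q≡))
    β∉ : β < 0ℚ ⊎ 1ℚ < β
    β∉ = at-outside c a β (b≢c ∘ trans b≡) (b≢a ∘ trans b≡) (b∉ca ∘ subst (OnOpenSeg c a) (sym b≡))

  open⇒closed : ∀ {a b p} → OnOpenSeg a b p → OnClosedSeg a b p
  open⇒closed (t , 0<t , t<1 , p≡) = t , <⇒≤ 0<t , <⇒≤ t<1 , p≡

  start∈closed : ∀ a b → OnClosedSeg a b a
  start∈closed a b = 0ℚ , ≤-refl , <⇒≤ 0<1 , sym (at-0 a b)

  end∈closed : ∀ a b → OnClosedSeg a b b
  end∈closed a b = 1ℚ , <⇒≤ 0<1 , ≤-refl , sym (at-1 a b)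

open Plane

import Data.Nat as ℕ
open import Data.Nat using (ℕ; zero; suc; _+_; _*_; _∸_; _/_; _≤_; _<_; z≤n; s≤s; z<s)
open import Data.Nat.Combinatorics using (_C_; nCk+nC[k+1]≡[n+1]C[k+1]; nC1≡n)
open import Data.Nat.DivMod using (m*n/n≡m; /-monoˡ-≤)
open import Data.Nat.Properties
open import Algebra.Properties.CommutativeSemigroup +-commutativeSemigroup
  using () renaming (interchange to +-interchange)
open import Data.Nat.Tactic.RingSolver using (solve-∀)

-- Counting

module _ {A : Set} where

  ∈-─⁺ : ∀ {x y} {xs : List A} (p : x ∈ xs) → x ≢ y → y ∈ xs → y ∈ xs ─ p
  ∈-─⁺ (here refl) x≢y (here refl) = ⊥-elim (x≢y refl)
  ∈-─⁺ (here _)    _   (there q)   = q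
  ∈-─⁺ (there _)   _   (here refl) = here refl
  ∈-─⁺ (there p)   x≢y (there q)   = there (∈-─⁺ p x≢y q)

  length-─ : ∀ {x} (xs : List A) (x∈xs : x ∈ xs) → length (xs ─ x∈xs) + 1 ≡ length xs
  length-─ xs x∈xs = trans (+-comm _ 1) (sym (length-removeAt′ xs (index x∈xs)))

  Unique-⊆⇒length≤ : ∀ {xs ys : List A} → Unique xs → xs ⊆ ys → length xs ≤ length ys
  Unique-⊆⇒length≤ {[]}     _            _  = z≤n
  Unique-⊆⇒length≤ {x ∷ xs} {ys} (x∉xs ∷ u) xs⊆ys = begin
    suc (length xs)           ≤⟨ s≤s (Unique-⊆⇒length≤ u xs⊆ys─x) ⟩
    suc (length (ys ─ x∈ys))  ≡⟨ +-comm 1 _ ⟩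
    length (ys ─ x∈ys) + 1    ≡⟨ length-─ ys x∈ys ⟩
    length ys                 ∎
    where
    open ≤-Reasoning
    x∈ys : x ∈ ys
    x∈ys = xs⊆ys (here refl)
    xs⊆ys─x : xs ⊆ ys ─ x∈ys
    xs⊆ys─x y∈xs = ∈-─⁺ x∈ys (All.lookup x∉xs y∈xs) (xs⊆ys (there y∈xs))

length-cartesianProductWith : ∀ {A B C : Set} (f : A → B → C) xs ys →
  length (cartesianProductWith f xs ys) ≡ length xs * length ys
length-cartesianProductWith f []       ys = refl
length-cartesianProductWith f (x ∷ xs) ys = begin
  length (map (f x) ys ++ cartesianProductWith f xs ys)
    ≡⟨ length-++ (map (f x) ys) ⟩
  length (map (f x) ys) + length (cartesianProductWith f xs ys)
    ≡⟨ cong₂ _+_ (length-map (f x) ys) (length-cartesianProductWith f xs ys) ⟩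
  length ys + length xs * length ys ∎
  where open ≡-Reasoning

Below : ℕ → Set
Below n = Σ ℕ (_< n)

≡-below : ∀ {n} {x y : Below n} → proj₁ x ≡ proj₁ y → x ≡ y
≡-below {x = j , p} {y = .j , q} refl = cong (j ,_) (<-irrelevant p q)

shift : ∀ {n} → Below n → Below (suc n)
shift (j , j<n) = suc j , s≤s j<n

below : (n : ℕ) → List (Below n)
below zero    = []
below (suc n) = (0 , z<s) ∷ map shift (below n)

length-below : ∀ n → length (below n) ≡ n
length-below zero    = refl
length-below (suc n) = cong suc (trans (length-map shift (below n)) (length-below n))

∈-below : ∀ {n} (j : Below n) → j ∈ below n
∈-below {suc n} (zero  , _)     = here (cong (0 ,_) (<-irrelevant _ _))
∈-below {suc n} (suc j , s≤s p) = there (∈-map⁺ shift (∈-below (j , p)))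

finSum-cong : ∀ k {f g : Fin k → ℕ} → (∀ i → f i ≡ g i) → finSum k f ≡ finSum k g
finSum-cong zero    f≗g = refl
finSum-cong (suc k) f≗g = cong₂ _+_ (f≗g fzero) (finSum-cong k (f≗g ∘ fsuc))

finSum-mono : ∀ k {f g : Fin k → ℕ} → (∀ i → f i ≤ g i) → finSum k f ≤ finSum k g
finSum-mono zero    f≤g = z≤n
finSum-mono (suc k) f≤g = +-mono-≤ (f≤g fzero) (finSum-mono k (f≤g ∘ fsuc))

finSum-distrib-+ : ∀ k (f g : Fin k → ℕ) → finSum k (λ i → f i + g i) ≡ finSum k f + finSum k g
finSum-distrib-+ zero    f g = refl
finSum-distrib-+ (suc k) f g = begin
  f fzero + g fzero + finSum k (λ i → f (fsuc i) + g (fsuc i))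
    ≡⟨ cong (f fzero + g fzero +_) (finSum-distrib-+ k (f ∘ fsuc) (g ∘ fsuc)) ⟩
  f fzero + g fzero + (finSum k (f ∘ fsuc) + finSum k (g ∘ fsuc))
    ≡⟨ +-interchange (f fzero) (g fzero) _ _ ⟩
  f fzero + finSum k (f ∘ fsuc) + (g fzero + finSum k (g ∘ fsuc)) ∎
  where open ≡-Reasoning

finSum-const : ∀ k c → finSum k (λ _ → c) ≡ k * c
finSum-const zero    c = refl
finSum-const (suc k) c = cong (c +_) (finSum-const k c)

*-distribˡ-finSum : ∀ k c (f : Fin k → ℕ) → c * finSum k f ≡ finSum k (λ i → c * f i)
*-distribˡ-finSum zero    c f = *-zeroʳ c
*-distribˡ-finSum (suc k) c f =
  trans (*-distribˡ-+ c (f fzero) _) (cong (c * f fzero +_) (*-distribˡ-finSum k c (f ∘ fsuc)))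

concatFin : ∀ {A : Set} k → (Fin k → List A) → List A
concatFin zero    xss = []
concatFin (suc k) xss = xss fzero ++ concatFin k (xss ∘ fsuc)

length-concatFin : ∀ {A : Set} k (xss : Fin k → List A) →
  length (concatFin k xss) ≡ finSum k (length ∘ xss)
length-concatFin zero    xss = refl
length-concatFin (suc k) xss =
  trans (length-++ (xss fzero)) (cong (length (xss fzero) +_) (length-concatFin k (xss ∘ fsuc)))

∈-concatFin⁺ : ∀ {A : Set} {k} (xss : Fin k → List A) i {x} → x ∈ xss i → x ∈ concatFin k xss
∈-concatFin⁺ xss fzero    x∈ = ∈-++⁺ˡ x∈
∈-concatFin⁺ xss (fsuc i) x∈ = ∈-++⁺ʳ (xss fzero) (∈-concatFin⁺ (xss ∘ fsuc) i x∈)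

pairSum : ∀ k → (Fin k → Fin k → ℕ) → ℕ
pairSum zero    f = 0
pairSum (suc k) f = finSum k (f fzero ∘ fsuc) + pairSum k (λ i j → f (fsuc i) (fsuc j))

pairSum-mono : ∀ k {f g : Fin k → Fin k → ℕ} → (∀ i j → f i j ≤ g i j) → pairSum k f ≤ pairSum k g
pairSum-mono zero    f≤g = z≤n
pairSum-mono (suc k) f≤g =
  +-mono-≤ (finSum-mono k (f≤g fzero ∘ fsuc)) (pairSum-mono k (λ i j → f≤g (fsuc i) (fsuc j)))

[1+n]C2≡n+nC2 : ∀ n → suc n C 2 ≡ n + n C 2
[1+n]C2≡n+nC2 n = trans (sym (nCk+nC[k+1]≡[n+1]C[k+1] n 1)) (cong (_+ n C 2) (nC1≡n n))

[m+n]C2≡mC2+nC2+m*n : ∀ m n → (m + n) C 2 ≡ m C 2 + n C 2 + m * n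
[m+n]C2≡mC2+nC2+m*n zero    n = sym (+-identityʳ (n C 2))
[m+n]C2≡mC2+nC2+m*n (suc m) n = begin
  suc (m + n) C 2                    ≡⟨ [1+n]C2≡n+nC2 (m + n) ⟩
  m + n + (m + n) C 2                ≡⟨ cong (m + n +_) ([m+n]C2≡mC2+nC2+m*n m n) ⟩
  m + n + (m C 2 + n C 2 + m * n)    ≡⟨ regroup m n (m C 2) (n C 2) ⟩
  m + m C 2 + n C 2 + suc m * n      ≡⟨ cong (λ x → x + n C 2 + suc m * n) ([1+n]C2≡n+nC2 m) ⟨
  suc m C 2 + n C 2 + suc m * n      ∎
  where
  open ≡-Reasoning
  regroup : ∀ m n x y → m + n + (x + y + m * n) ≡ m + x + y + (n + m * n)
  regroup = solve-∀

δ : Bool → Bool → ℕ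
δ true  true  = 1
δ false false = 1
δ _     _     = 0

δ≤1 : ∀ b c → δ b c ≤ 1
δ≤1 true  true  = ≤-refl
δ≤1 true  false = z≤n
δ≤1 false true  = z≤n
δ≤1 false false = ≤-refl

δ-≢ : ∀ {b c} → b ≢ c → δ b c ≡ 0
δ-≢ {true}  {true}  b≢c = ⊥-elim (b≢c refl)
δ-≢ {true}  {false} _   = refl
δ-≢ {false} {true}  _   = refl
δ-≢ {false} {false} b≢c = ⊥-elim (b≢c refl)

module _ (k : ℕ) (colour : Fin k → Bool) where

  colourCount : Bool → ℕ
  colourCount b = finSum k (δ b ∘ colour)

  monochromaticPairs : ℕ
  monochromaticPairs = pairSum k (λ i j → δ (colour i) (colour j))

colourCount-true+false : ∀ k c → colourCount k c true + colourCount k c false ≡ k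
colourCount-true+false k c = begin
  colourCount k c true + colourCount k c false    ≡⟨ finSum-distrib-+ k _ _ ⟨
  finSum k (λ i → δ true (c i) + δ false (c i))   ≡⟨ finSum-cong k (δ-true+false ∘ c) ⟩
  finSum k (λ _ → 1)                              ≡⟨ finSum-const k 1 ⟩
  k * 1                                           ≡⟨ *-identityʳ k ⟩
  k                                               ∎
  where
  open ≡-Reasoning
  δ-true+false : ∀ b → δ true b + δ false b ≡ 1
  δ-true+false true  = refl
  δ-true+false false = refl

monochromaticPairs+bichromatic≡C2 : ∀ k c →
  monochromaticPairs k c + colourCount k c true * colourCount k c false ≡ k C 2
monochromaticPairs+bichromatic≡C2 zero    c = refl
monochromaticPairs+bichromatic≡C2 (suc k) c = begin
  monochromaticPairs (suc k) c + colourCount (suc k) c true * colourCount (suc k) c false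
    ≡⟨ regroup (c fzero) ⟩
  a + b + (m + a * b)
    ≡⟨ cong₂ _+_ (colourCount-true+false k (c ∘ fsuc)) (monochromaticPairs+bichromatic≡C2 k (c ∘ fsuc)) ⟩
  k + k C 2
    ≡⟨ [1+n]C2≡n+nC2 k ⟨
  suc k C 2 ∎
  where
  open ≡-Reasoning
  a = colourCount k (c ∘ fsuc) true
  b = colourCount k (c ∘ fsuc) false
  m = monochromaticPairs k (c ∘ fsuc)
  regroup : ∀ b₀ → finSum k (δ b₀ ∘ c ∘ fsuc) + m + (δ true b₀ + a) * (δ false b₀ + b) ≡ a + b + (m + a * b)
  regroup true  = lemma a b m
    where lemma : ∀ a b m → a + m + suc a * b ≡ a + b + (m + a * b)
          lemma = solve-∀
  regroup false = lemma a b m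
    where lemma : ∀ a b m → b + m + a * suc b ≡ a + b + (m + a * b)
          lemma = solve-∀

4*m*n≤[m+n]² : ∀ m n → 4 * (m * n) ≤ (m + n) * (m + n)
4*m*n≤[m+n]² m n = [ ordered , swapped ]′ (≤-total m n)
  where
  ordered : ∀ {m n} → m ≤ n → 4 * (m * n) ≤ (m + n) * (m + n)
  ordered {m} m≤n = subst (λ n → 4 * (m * n) ≤ (m + n) * (m + n)) (m+[n∸m]≡n m≤n) (gap m _)
    where
    expand : ∀ m d → 4 * (m * (m + d)) + d * d ≡ (m + (m + d)) * (m + (m + d))
    expand = solve-∀
    gap : ∀ m d → 4 * (m * (m + d)) ≤ (m + (m + d)) * (m + (m + d))
    gap m d = subst (4 * (m * (m + d)) ≤_) (expand m d) (m≤m+n _ (d * d))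
  swapped : n ≤ m → 4 * (m * n) ≤ (m + n) * (m + n)
  swapped n≤m = subst₂ _≤_ (cong (4 *_) (*-comm n m)) (cong (λ x → x * x) (+-comm n m)) (ordered n≤m)

m*n≤[m+n]²/4 : ∀ m n → m * n ≤ (m + n) * (m + n) / 4
m*n≤[m+n]²/4 m n = subst (_≤ (m + n) * (m + n) / 4) (m*n/n≡m (m * n) 4)
  (/-monoˡ-≤ 4 (subst (_≤ (m + n) * (m + n)) (*-comm 4 (m * n)) (4*m*n≤[m+n]² m n)))

C2≤monochromaticPairs+k²/4 : ∀ k c → k C 2 ≤ monochromaticPairs k c + k * k / 4
C2≤monochromaticPairs+k²/4 k c = begin
  k C 2                                   ≡⟨ monochromaticPairs+bichromatic≡C2 k c ⟨
  monochromaticPairs k c + r * b          ≤⟨ +-monoʳ-≤ (monochromaticPairs k c) (m*n≤[m+n]²/4 r b) ⟩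
  monochromaticPairs k c + (r + b) * (r + b) / 4
    ≡⟨ cong (λ n → monochromaticPairs k c + n * n / 4) (colourCount-true+false k c) ⟩
  monochromaticPairs k c + k * k / 4      ∎
  where
  open ≤-Reasoning
  r = colourCount k c true
  b = colourCount k c false

-- Candidate crossings of a spider

fromOrigin : ∀ {n} → Below n → Below (2 + n) × Below (2 + n)
fromOrigin j = (0 , z<s) , shift (shift j)

shiftPair : ∀ {n} → Below n × Below n → Below (suc n) × Below (suc n)
shiftPair (j , j′) = shift j , shift j′

nonAdjacentPairs : (n : ℕ) → List (Below n × Below n)
nonAdjacentPairs zero          = []
nonAdjacentPairs (suc zero)    = []
nonAdjacentPairs (suc (suc n)) = map fromOrigin (below n) ++ map shiftPair (nonAdjacentPairs (suc n))

length-nonAdjacentPairs : ∀ n → length (nonAdjacentPairs n) + (n ∸ 1) ≡ n C 2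
length-nonAdjacentPairs zero          = refl
length-nonAdjacentPairs (suc zero)    = refl
length-nonAdjacentPairs (suc (suc n)) = begin
  length (firsts ++ rest) + suc n       ≡⟨ cong (_+ suc n) (length-++ firsts) ⟩
  length firsts + length rest + suc n   ≡⟨ cong₂ (λ x y → x + y + suc n)
                                                 (trans (length-map fromOrigin (below n)) (length-below n))
                                                 (length-map shiftPair (nonAdjacentPairs (suc n))) ⟩
  n + r + suc n                         ≡⟨ regroup n r ⟩
  suc n + (r + n)                       ≡⟨ cong (suc n +_) (length-nonAdjacentPairs (suc n)) ⟩
  suc n + suc n C 2                     ≡⟨ [1+n]C2≡n+nC2 (suc n) ⟨
  suc (suc n) C 2                       ∎
  where
  open ≡-Reasoning
  firsts = map fromOrigin (below n)
  rest   = map shiftPair (nonAdjacentPairs (suc n))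
  r = length (nonAdjacentPairs (suc n))
  regroup : ∀ n r → n + r + suc n ≡ suc n + (r + n)
  regroup = solve-∀

∈-nonAdjacentPairs : ∀ {n} (x y : Below n) → 2 + proj₁ x ≤ proj₁ y → (x , y) ∈ nonAdjacentPairs n
∈-nonAdjacentPairs {suc (suc n)} (zero , _) (suc (suc j′) , s≤s (s≤s j′<n)) _ =
  ∈-++⁺ˡ (subst (_∈ map fromOrigin (below n)) (cong (_, shift (shift (j′ , j′<n))) (≡-below refl))
                (∈-map⁺ fromOrigin (∈-below (j′ , j′<n))))
∈-nonAdjacentPairs {suc (suc n)} (zero , _) (suc zero , _) (s≤s ())
∈-nonAdjacentPairs {suc (suc n)} (suc j , s≤s j<) (suc j′ , s≤s j′<) (s≤s 2+j≤j′) =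
  ∈-++⁺ʳ _ (∈-map⁺ shiftPair (∈-nonAdjacentPairs (j , j<) (j′ , j′<) 2+j≤j′))

-- For legs i < i′ with edges numbered from the centre, excl₀₁ drops the pair (edge 0 of leg i,
-- edge 1 of leg i′) from the candidate crossings, and excl₁₀ the pair (edge 1 of i, edge 0 of i′).
data Exclusion : Set where
  none excl₀₁ excl₁₀ : Exclusion

excluded : Exclusion → ℕ
excluded none   = 0
excluded excl₀₁ = 1
excluded excl₁₀ = 1

Permits : Exclusion → ℕ → ℕ → Set
Permits none   j j′ = ⊤
Permits excl₀₁ j j′ = ¬ (j ≡ 0 × j′ ≡ 1)
Permits excl₁₀ j j′ = ¬ (j ≡ 1 × j′ ≡ 0)

module _ {n m : ℕ} (1<n : 1 < n) (1<m : 1 < m) where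

  private
    0ⁿ 1ⁿ : Below n
    0ⁿ = 0 , <-trans z<s 1<n
    1ⁿ = 1 , 1<n
    0ᵐ 1ᵐ : Below m
    0ᵐ = 0 , <-trans z<s 1<m
    1ᵐ = 1 , 1<m

    grid : List (Below n × Below m)
    grid = cartesianProduct (below n) (below m)

    ∈grid : ∀ x y → (x , y) ∈ grid
    ∈grid x y = ∈-cartesianProduct⁺ (∈-below x) (∈-below y)

    pair-≢ : ∀ {x x′ : Below n} {y y′ : Below m} →
      ¬ (proj₁ x ≡ proj₁ x′ × proj₁ y ≡ proj₁ y′) → (x , y) ≢ (x′ , y′)
    pair-≢ ≢ refl = ≢ (refl , refl)

    grid⁻ : List (Below n × Below m)
    grid⁻ = grid ─ ∈grid 0ⁿ 0ᵐ

    ∈grid⁻ : ∀ x y → ¬ (proj₁ x ≡ 0 × proj₁ y ≡ 0) → (x , y) ∈ grid⁻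
    ∈grid⁻ x y ≢00 = ∈-─⁺ (∈grid 0ⁿ 0ᵐ) (pair-≢ λ (x≡0 , y≡0) → ≢00 (sym x≡0 , sym y≡0)) (∈grid x y)

    ∈01 : (0ⁿ , 1ᵐ) ∈ grid⁻
    ∈01 = ∈grid⁻ 0ⁿ 1ᵐ λ ()
    ∈10 : (1ⁿ , 0ᵐ) ∈ grid⁻
    ∈10 = ∈grid⁻ 1ⁿ 0ᵐ λ ()

  crossPairs : Exclusion → List (Below n × Below m)
  crossPairs none   = grid⁻
  crossPairs excl₀₁ = grid⁻ ─ ∈01
  crossPairs excl₁₀ = grid⁻ ─ ∈10

  length-crossPairs : ∀ ex → length (crossPairs ex) + 1 + excluded ex ≡ n * m
  length-crossPairs ex = begin
    length (crossPairs ex) + 1 + excluded ex   ≡⟨ lemma ex ⟩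
    length grid⁻ + 1                           ≡⟨ length-─ grid (∈grid 0ⁿ 0ᵐ) ⟩
    length grid                                ≡⟨ length-cartesianProductWith _,_ (below n) (below m) ⟩
    length (below n) * length (below m)        ≡⟨ cong₂ _*_ (length-below n) (length-below m) ⟩
    n * m                                      ∎
    where
    open ≡-Reasoning
    lemma : ∀ ex → length (crossPairs ex) + 1 + excluded ex ≡ length grid⁻ + 1
    lemma none   = +-identityʳ _
    lemma excl₀₁ = cong (_+ 1) (length-─ grid⁻ ∈01)
    lemma excl₁₀ = cong (_+ 1) (length-─ grid⁻ ∈10)

  ∈-crossPairs : ∀ ex x y → ¬ (proj₁ x ≡ 0 × proj₁ y ≡ 0) → Permits ex (proj₁ x) (proj₁ y) →
    (x , y) ∈ crossPairs ex
  ∈-crossPairs none   x y ≢00 _   = ∈grid⁻ x y ≢00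
  ∈-crossPairs excl₀₁ x y ≢00 ≢01 =
    ∈-─⁺ ∈01 (pair-≢ λ (0≡x , 1≡y) → ≢01 (sym 0≡x , sym 1≡y)) (∈grid⁻ x y ≢00)
  ∈-crossPairs excl₁₀ x y ≢00 ≢10 =
    ∈-─⁺ ∈10 (pair-≢ λ (1≡x , 0≡y) → ≢10 (sym 1≡x , sym 0≡y)) (∈grid⁻ x y ≢00)

EdgePair : (k : ℕ) → (Fin k → ℕ) → Set
EdgePair k ℓ = Edge k ℓ × Edge k ℓ

pairOn : ∀ {k ℓ} (i i′ : Fin k) → Below (ℓ i) × Below (ℓ i′) → EdgePair k ℓ
pairOn i i′ (x , y) = (i , x) , (i′ , y)

shiftLegs : ∀ {k ℓ} → EdgePair k (ℓ ∘ fsuc) → EdgePair (suc k) ℓ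
shiftLegs ((i , x) , (i′ , y)) = (fsuc i , x) , (fsuc i′ , y)

firstLegPairs : ∀ {k} ℓ → List (EdgePair (suc k) ℓ)
firstLegPairs ℓ = map (pairOn fzero fzero) (nonAdjacentPairs (ℓ fzero))

firstLegCrossPairs : ∀ {k ℓ} → (∀ i → 1 < ℓ i) → (Fin (suc k) → Fin (suc k) → Exclusion) →
  List (EdgePair (suc k) ℓ)
firstLegCrossPairs {k} 1<ℓ ex = concatFin k λ i →
  map (pairOn fzero (fsuc i)) (crossPairs (1<ℓ fzero) (1<ℓ (fsuc i)) (ex fzero (fsuc i)))

candidates : ∀ k (ℓ : Fin k → ℕ) → (∀ i → 1 < ℓ i) → (Fin k → Fin k → Exclusion) → List (EdgePair k ℓ)
candidates zero    ℓ 1<ℓ ex = []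
candidates (suc k) ℓ 1<ℓ ex =
  firstLegPairs ℓ ++ firstLegCrossPairs 1<ℓ ex
  ++ map (shiftLegs {ℓ = ℓ}) (candidates k (ℓ ∘ fsuc) (1<ℓ ∘ fsuc) (λ i i′ → ex (fsuc i) (fsuc i′)))

Allowed : ∀ {k ℓ} → (Fin k → Fin k → Exclusion) → EdgePair k ℓ → Set
Allowed ex ((i , j , _) , (i′ , j′ , _)) =
  (i ≡ i′ × 2 + j ≤ j′) ⊎ (toℕ i < toℕ i′ × ¬ (j ≡ 0 × j′ ≡ 0) × Permits (ex i i′) j j′)

∈-candidates : ∀ k ℓ (1<ℓ : ∀ i → 1 < ℓ i) ex {x} → Allowed ex x → x ∈ candidates k ℓ 1<ℓ ex
∈-candidates (suc k) ℓ 1<ℓ ex {(fzero , x) , (fzero , y)} (inj₁ (_ , 2+j≤j′)) =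
  ∈-++⁺ˡ (∈-map⁺ (pairOn fzero fzero) (∈-nonAdjacentPairs x y 2+j≤j′))
∈-candidates (suc k) ℓ 1<ℓ ex {(fzero , x) , (fsuc i′ , y)} (inj₂ (_ , ≢00 , permits)) =
  ∈-++⁺ʳ (firstLegPairs ℓ) (∈-++⁺ˡ (∈-concatFin⁺ _ i′ (∈-map⁺ (pairOn fzero (fsuc i′))
    (∈-crossPairs (1<ℓ fzero) (1<ℓ (fsuc i′)) (ex fzero (fsuc i′)) x y ≢00 permits))))
∈-candidates (suc k) ℓ 1<ℓ ex {(fsuc i , x) , (fsuc i′ , y)} allowed =
  ∈-++⁺ʳ (firstLegPairs ℓ) (∈-++⁺ʳ (firstLegCrossPairs {ℓ = ℓ} 1<ℓ ex) (∈-map⁺ (shiftLegs {ℓ = ℓ})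
    (∈-candidates k (ℓ ∘ fsuc) (1<ℓ ∘ fsuc) (λ i i′ → ex (fsuc i) (fsuc i′)) (unshift allowed))))
  where
  unshift : Allowed {ℓ = ℓ} ex ((fsuc i , x) , (fsuc i′ , y)) →
            Allowed {ℓ = ℓ ∘ fsuc} (λ i i′ → ex (fsuc i) (fsuc i′)) ((i , x) , (i′ , y))
  unshift (inj₁ (i≡i′ , 2+j≤j′))             = inj₁ (Fin.suc-injective i≡i′ , 2+j≤j′)
  unshift (inj₂ (s≤s i<i′ , ≢00 , permits)) = inj₂ (i<i′ , ≢00 , permits)
∈-candidates (suc k) ℓ 1<ℓ ex {(fzero , _) , (fzero , _)} (inj₂ (() , _))
∈-candidates (suc k) ℓ 1<ℓ ex {(fzero , _) , (fsuc _ , _)} (inj₁ (() , _))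
∈-candidates (suc k) ℓ 1<ℓ ex {(fsuc _ , _) , (fzero , _)} (inj₁ (() , _))
∈-candidates (suc k) ℓ 1<ℓ ex {(fsuc _ , _) , (fzero , _)} (inj₂ (() , _))

length-concat-crossPairs : ∀ {A : Set} k {n} {m : Fin k → ℕ} (1<n : 1 < n) (1<m : ∀ i → 1 < m i)
  (ex : Fin k → Exclusion) (f : ∀ i → Below n × Below (m i) → A) →
  length (concatFin k (λ i → map (f i) (crossPairs 1<n (1<m i) (ex i)))) + k + finSum k (excluded ∘ ex)
    ≡ n * finSum k m
length-concat-crossPairs k {n} {m} 1<n 1<m ex f = begin
  length (concatFin k blocks) + k + finSum k (excluded ∘ ex)
    ≡⟨ cong₂ (λ a b → a + b + finSum k (excluded ∘ ex)) (length-concatFin k blocks) k≡Σ1 ⟩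
  finSum k (length ∘ blocks) + finSum k (λ _ → 1) + finSum k (excluded ∘ ex)
    ≡⟨ cong (_+ finSum k (excluded ∘ ex)) (finSum-distrib-+ k _ _) ⟨
  finSum k (λ i → length (blocks i) + 1) + finSum k (excluded ∘ ex)
    ≡⟨ finSum-distrib-+ k _ _ ⟨
  finSum k (λ i → length (blocks i) + 1 + excluded (ex i))
    ≡⟨ finSum-cong k (λ i → trans (cong (λ a → a + 1 + excluded (ex i)) (length-map (f i) (pairs i)))
                                  (length-crossPairs 1<n (1<m i) (ex i))) ⟩
  finSum k (λ i → n * m i)
    ≡⟨ *-distribˡ-finSum k n m ⟨
  n * finSum k m ∎
  where
  open ≡-Reasoning
  pairs = λ i → crossPairs 1<n (1<m i) (ex i)
  blocks = λ i → map (f i) (pairs i)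
  k≡Σ1 : k ≡ finSum k (λ _ → 1)
  k≡Σ1 = sym (trans (finSum-const k 1) (*-identityʳ k))

length-candidates : ∀ k ℓ (1<ℓ : ∀ i → 1 < ℓ i) ex →
  length (candidates k ℓ 1<ℓ ex) + pairSum k (λ i i′ → excluded (ex i i′))
    + (k C 2 + finSum k (λ i → ℓ i ∸ 1)) ≡ finSum k ℓ C 2
length-candidates zero    ℓ 1<ℓ ex = refl
length-candidates (suc k) ℓ 1<ℓ ex = begin
  length (A ++ M ++ R) + (E₀ + E′) + (suc k C 2 + (d₀ + D′))
    ≡⟨ cong₂ (λ a b → a + (E₀ + E′) + (b + (d₀ + D′)))
             (trans (length-++ A {M ++ R}) (cong (length A +_) (length-++ M {R}))) ([1+n]C2≡n+nC2 k) ⟩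
  length A + (length M + length R) + (E₀ + E′) + (k + k C 2 + (d₀ + D′))
    ≡⟨ regroup (length A) (length M) (length R) E₀ E′ k (k C 2) d₀ D′ ⟩
  (length A + d₀) + (length R + E′ + (k C 2 + D′)) + (length M + k + E₀)
    ≡⟨ cong₂ _+_ (cong₂ _+_ first-leg rest) middle ⟩
  ℓ₀ C 2 + N′ C 2 + ℓ₀ * N′
    ≡⟨ [m+n]C2≡mC2+nC2+m*n ℓ₀ N′ ⟨
  (ℓ₀ + N′) C 2 ∎
  where
  open ≡-Reasoning
  ℓ₀ = ℓ fzero
  N′ = finSum k (ℓ ∘ fsuc)
  d₀ = ℓ₀ ∸ 1
  D′ = finSum k (λ i → ℓ (fsuc i) ∸ 1)
  ex′ = λ i i′ → ex (fsuc i) (fsuc i′)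
  E₀ = finSum k (λ i → excluded (ex fzero (fsuc i)))
  E′ = pairSum k (λ i i′ → excluded (ex′ i i′))
  A = firstLegPairs ℓ
  M = firstLegCrossPairs 1<ℓ ex
  R′ = candidates k (ℓ ∘ fsuc) (1<ℓ ∘ fsuc) ex′
  R = map (shiftLegs {ℓ = ℓ}) R′
  regroup : ∀ a m r e e′ k c d d′ →
    a + (m + r) + (e + e′) + (k + c + (d + d′)) ≡ (a + d) + (r + e′ + (c + d′)) + (m + k + e)
  regroup = solve-∀
  first-leg : length A + d₀ ≡ ℓ₀ C 2
  first-leg = trans (cong (_+ d₀) (length-map _ (nonAdjacentPairs ℓ₀))) (length-nonAdjacentPairs ℓ₀)
  middle : length M + k + E₀ ≡ ℓ₀ * N′
  middle = length-concat-crossPairs k (1<ℓ fzero) (1<ℓ ∘ fsuc) (ex fzero ∘ fsuc) (pairOn fzero ∘ fsuc)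
  rest : length R + E′ + (k C 2 + D′) ≡ N′ C 2
  rest = trans (cong (λ r → r + E′ + (k C 2 + D′)) (length-map (shiftLegs {ℓ = ℓ}) R′))
               (length-candidates k (ℓ ∘ fsuc) (1<ℓ ∘ fsuc) ex′)

module _ {k : ℕ} {ℓ : Fin k → ℕ} (i : Fin k) where

  legSum-interior : ∀ n (n≤ℓ : n ≤ ℓ i) → n < ℓ i → legSum {k} {ℓ} i n n≤ℓ ≡ n
  legSum-interior zero    _ _ = refl
  legSum-interior (suc n) _ n<ℓ with suc n ℕ.≟ ℓ i
  ... | yes 1+n≡ℓ = ⊥-elim (<-irrefl 1+n≡ℓ n<ℓ)
  ... | no  _     = cong suc (legSum-interior n _ (<-trans (n<1+n n) n<ℓ))

  legSum-leg : ∀ n (n≤ℓ : n ≤ ℓ i) → n ≡ ℓ i → legSum {k} {ℓ} i n n≤ℓ ≡ n ∸ 1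
  legSum-leg zero    _   _     = refl
  legSum-leg (suc n) n<ℓ 1+n≡ℓ with suc n ℕ.≟ ℓ i
  ... | yes _    = legSum-interior n _ n<ℓ
  ... | no 1+n≢ℓ = ⊥-elim (1+n≢ℓ 1+n≡ℓ)

sumDegC2≡ : ∀ k ℓ → sumDegC2 k ℓ ≡ k C 2 + finSum k (λ i → ℓ i ∸ 1)
sumDegC2≡ k ℓ = cong (k C 2 +_) (finSum-cong k (λ i → legSum-leg i (ℓ i) ≤-refl refl))

thrackle≡ : ∀ k ℓ (1<ℓ : ∀ i → 1 < ℓ i) ex →
  thrackle k ℓ ≡ length (candidates k ℓ 1<ℓ ex) + pairSum k (λ i i′ → excluded (ex i i′))
thrackle≡ k ℓ 1<ℓ ex = begin
  finSum k ℓ C 2 ∸ sumDegC2 k ℓ      ≡⟨ cong₂ _∸_ (length-candidates k ℓ 1<ℓ ex) (sym (sumDegC2≡ k ℓ)) ⟨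
  nonAdjacent + adjacent ∸ adjacent  ≡⟨ m+n∸n≡m nonAdjacent adjacent ⟩
  nonAdjacent                        ∎
  where
  open ≡-Reasoning
  nonAdjacent = length (candidates k ℓ 1<ℓ ex) + pairSum k (λ i i′ → excluded (ex i i′))
  adjacent = k C 2 + finSum k (λ i → ℓ i ∸ 1)

module GoodDrawing {k : ℕ} {ℓ : Fin k → ℕ} (1<ℓ : ∀ i → 1 < ℓ i) (D : Drawing k ℓ) (good : IsGood D) where

  open IsGood good

  -- The bound proof of e₀ i is the one inner computes, so inner (e₁ i) reduces to just (e₀ i).
  e₀ e₁ : Fin k → Edge k ℓ
  e₀ i = i , 0 , ≤-trans (n≤1+n 1) (1<ℓ i)
  e₁ i = i , 1 , 1<ℓ i

  centre : Point
  centre = D nothing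

  a b : Fin k → Point
  a i = D (just (e₀ i))
  b i = D (just (e₁ i))

  colour : Fin k → Bool
  colour i = isPositive (orientation centre (a i) (b i))

  adjacent⇒¬Cross : ∀ e f v → OnEdge D e (D v) → OnEdge D f (D v) → ¬ Cross D e f
  adjacent⇒¬Cross e f v v∈e v∈f (e≢f , p , p∈e , p∈f) =
    noVertexOnEdge v e (subst (InteriorOfEdge D e) p≡v p∈e)
    where
    p≡v : p ≡ D v
    p≡v = atMostOnePoint e f e≢f p (D v)
      (open⇒closed {D (inner e)} {D (outer e)} p∈e) (open⇒closed {D (inner f)} {D (outer f)} p∈f) v∈e v∈f

  inner∈ : ∀ e → OnEdge D e (D (inner e))
  inner∈ e = start∈closed (D (inner e)) (D (outer e))

  outer∈ : ∀ e → OnEdge D e (D (outer e))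
  outer∈ e = end∈closed (D (inner e)) (D (outer e))

  Cross-sym : ∀ {e f} → Cross D e f → Cross D f e
  Cross-sym (e≢f , p , p∈e , p∈f) = e≢f ∘ sym , p , p∈f , p∈e

  private
    D-≢ : ∀ {u v} → u ≢ v → D u ≢ D v
    D-≢ u≢v = u≢v ∘ injective _ _

  crossing⇒sameSign : ∀ {i j} → i ≢ j → Cross D (e₀ i) (e₁ j) →
    SameSign (orientation centre (a j) (a i)) (orientation centre (a j) (b j))
  crossing⇒sameSign {i} {j} i≢j (_ , _ , p∈e₀@(t , 0<t , _ , p≡) , p∈e₁@(s , 0<s , _ , p≡′)) =
    positive-multiples-sameSign 0<t 0<s
      (crossing-orientations centre (a i) (a j) (b j) t s (trans (sym p≡) p≡′))
      (crossing⇒orientation≢0 centre (a i) (a j) (b j) p∈e₀ p∈e₁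
        (D-≢ λ ()) (D-≢ λ ()) (D-≢ (i≢j ∘ sym ∘ cong proj₁ ∘ just-injective)) (D-≢ λ ())
        (D-≢ λ eq → case cong (proj₁ ∘ proj₂) (just-injective eq) of λ ())
        (noVertexOnEdge (just (e₀ j)) (e₀ i)) (noVertexOnEdge (just (e₁ j)) (e₀ i))
        (noVertexOnEdge nothing (e₁ j)))

  colour-≢ : ∀ {i j} → i ≢ j → Cross D (e₀ i) (e₁ j) → Cross D (e₀ j) (e₁ i) → colour i ≢ colour j
  colour-≢ {i} {j} i≢j ij ji = sameSign-opposite⇒≢
    (crossing⇒sameSign (i≢j ∘ sym) ji) (crossing⇒sameSign i≢j ij) (orientation-antisym centre (a i) (a j))

edge-≡ : ∀ {k ℓ i j} {p q : j < ℓ i} → (Edge k ℓ ∋ (i , j , p)) ≡ (i , j , q)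
edge-≡ {i = i} {j} {p} {q} = cong (λ r → i , j , r) (<-irrelevant p q)

module Crossings {k : ℕ} {ℓ : Fin k → ℕ} (1<ℓ : ∀ i → 1 < ℓ i) (D : Drawing k ℓ) (good : IsGood D)
  (cs : List (EdgePair k ℓ))
  (crossings : All (λ ef → EdgeLt (proj₁ ef) (proj₂ ef) × Cross D (proj₁ ef) (proj₂ ef)) cs) where

  open GoodDrawing 1<ℓ D good

  _≟ᵖ_ : DecidableEquality (EdgePair k ℓ)
  _≟ᵖ_ = ≡-dec _≟ᵉ_ _≟ᵉ_
    where
    _≟ᵉ_ : DecidableEquality (Edge k ℓ)
    _≟ᵉ_ = ≡-dec Fin._≟_ (≡-dec ℕ._≟_ λ p q → yes (<-irrelevant p q))

  open DecMembership _≟ᵖ_ using (_∈?_)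

  -- For legs of the same colour the pairs (e₀ i , e₁ i′) and (e₁ i , e₀ i′) do not both cross
  -- (colour-≢), so one of them that is missing from cs is excluded.
  exclusion : Fin k → Fin k → Exclusion
  exclusion i i′ with colour i Bool.≟ colour i′ | (e₀ i , e₁ i′) ∈? cs
  ... | no _  | _     = none
  ... | yes _ | no _  = excl₀₁
  ... | yes _ | yes _ = excl₁₀

  δ≤excluded : ∀ i i′ → δ (colour i) (colour i′) ≤ excluded (exclusion i i′)
  δ≤excluded i i′ with colour i Bool.≟ colour i′ | (e₀ i , e₁ i′) ∈? cs
  ... | no ≢  | _     = ≤-reflexive (δ-≢ ≢)
  ... | yes _ | no _  = δ≤1 (colour i) (colour i′)
  ... | yes _ | yes _ = δ≤1 (colour i) (colour i′)

  crossing : ∀ {x} → x ∈ cs → Cross D (proj₁ x) (proj₂ x)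
  crossing = proj₂ ∘ All.lookup crossings

  permits : ∀ {i i′ j j′ p p′} → toℕ i < toℕ i′ → ((i , j , p) , (i′ , j′ , p′)) ∈ cs →
    Permits (exclusion i i′) j j′
  permits {i} {i′} i<i′ x∈cs with colour i Bool.≟ colour i′ | (e₀ i , e₁ i′) ∈? cs
  ... | no _     | _     = tt
  ... | yes _    | no ∉  = λ { (refl , refl) → ∉ (subst (_∈ cs) (cong₂ _,_ edge-≡ edge-≡) x∈cs) }
  ... | yes same | yes ∈ = λ { (refl , refl) → colour-≢ (<⇒≢ i<i′ ∘ cong toℕ) (crossing ∈)
      (Cross-sym (crossing (subst (_∈ cs) (cong₂ _,_ edge-≡ edge-≡) x∈cs))) same }

  allowed : ∀ {x} → x ∈ cs → Allowed exclusion x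
  allowed {(i , j , p) , (i′ , j′ , p′)} x∈cs with All.lookup crossings x∈cs
  ... | inj₁ i<i′ , cross = inj₂ (i<i′ , ¬00 , permits i<i′ x∈cs)
    where
    ¬00 : ¬ (j ≡ 0 × j′ ≡ 0)
    ¬00 (refl , refl) = adjacent⇒¬Cross _ _ nothing (inner∈ (i , 0 , p)) (inner∈ (i′ , 0 , p′)) cross
  ... | inj₂ (refl , j<j′) , cross = inj₁ (refl , ≤∧≢⇒< j<j′ 1+j≢j′)
    where
    1+j≢j′ : suc j ≢ j′
    1+j≢j′ refl = adjacent⇒¬Cross _ _ (just (i , j , p)) (outer∈ (i , j , p))
      (subst (λ v → OnEdge D (i , j′ , p′) (D (just v))) edge-≡ (inner∈ (i , j′ , p′))) cross

proposition2 : (k : ℕ) → 3 ≤ k → (ℓ : Fin k → ℕ) → (∀ i → 2 ≤ ℓ i) →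
    (D : Drawing k ℓ) → IsGood D →
    (cs : List (Edge k ℓ × Edge k ℓ)) → Unique cs →
    All (λ ef → EdgeLt (proj₁ ef) (proj₂ ef) × Cross D (proj₁ ef) (proj₂ ef)) cs →
    length cs + (k C 2) ≤ thrackle k ℓ + (k * k) / 4
-- The bound holds for every number of legs.
proposition2 k _ ℓ 1<ℓ D good cs unique crossings = begin
  length cs + k C 2
    ≤⟨ +-mono-≤ (Unique-⊆⇒length≤ unique (∈-candidates k ℓ 1<ℓ exclusion ∘ allowed))
                (C2≤monochromaticPairs+k²/4 k colour) ⟩
  length L + (monochromaticPairs k colour + k * k / 4)
    ≤⟨ +-monoʳ-≤ (length L) (+-monoˡ-≤ (k * k / 4) (pairSum-mono k δ≤excluded)) ⟩
  length L + (E + k * k / 4)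
    ≡⟨ +-assoc (length L) E (k * k / 4) ⟨
  length L + E + k * k / 4
    ≡⟨ cong (_+ k * k / 4) (thrackle≡ k ℓ 1<ℓ exclusion) ⟨
  thrackle k ℓ + k * k / 4 ∎
  where
  open ≤-Reasoning
  open Crossings 1<ℓ D good cs crossings
  open GoodDrawing 1<ℓ D good using (colour)
  L = candidates k ℓ 1<ℓ exclusion
  E = pairSum k (λ i i′ → excluded (exclusion i i′))
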